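{- Let $\mathcal Q=(W,\preccurlyeq,S,\ell)$ be a quasimodel, $((w_i,\Phi_i))_{i<n}$ a typed path on $\mathcal Q$ with $n\ge1$, and $v_0\in W$ with $w_0\preccurlyeq v_0$. Then there is a typed path $((v_i,\Psi_i))_{i<n}$ on $\mathcal Q$ (starting at the given $v_0$) such that $w_i\preccurlyeq v_i$ and $\Phi_i\preccurlyeq_T\Psi_i$ for all $i<n$.
   Context: $\mathcal L_\Diamond$ is the language built from a countable set of propositional variables by $\varphi ::= \bot \mid p \mid \varphi\wedge\varphi \mid \varphi\vee\varphi\mid \varphi\to\varphi\mid \circ\varphi\mid\Diamond\varphi$. A (two-sided) type is a pair $\Phi=(\Phi^-;\Phi^+)$ of finite subsets of $\mathcal L_\Diamond$ such that: $\Phi^-\cap\Phi^+=\varnothing$; $\bot\notin\Phi^+$; if $\varphi\wedge\psi\in\Phi^+$ then $\varphi,\psi\in\Phi^+$; if $\varphi\wedge\psi\in\Phi^-$ then $\varphi\in\Phi^-$ or $\psi\in\Phi^-$; if $\varphi\vee\psi\in\Phi^+$ then $\varphi\in\Phi^+$ or $\psi\in\Phi^+$; if $\varphi\vee\psi\in\Phi^-$ then $\varphi,\psi\in\Phi^-$; if $\varphi\to\psi\in\Phi^+$ then $\varphi\in\Phi^-$ or $\psi\in\Phi^+$; if $\Diamond\varphi\in\Phi^-$ then $\varphi\in\Phi^-$. $\Phi\preccurlyeq_T\Psi$ iff $\Psi^-\subseteq\Phi^-$ and $\Phi^+\subseteq\Psi^+$; $\Phi\sqsubseteq_T\Psi$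 iff $\Phi^-=\Psi^-$ and $\Phi^+\subseteq\Psi^+$. $\Phi\mathrel{S_T}\Psi$ iff for all $\varphi$: if $\circ\varphi\in\Phi^+$ then $\varphi\in\Psi^+$; if $\circ\varphi\in\Phi^-$ then $\varphi\in\Psi^-$; if $\Diamond\varphi\in\Phi^+$ then $\varphi\in\Phi^+$ or $\Diamond\varphi\in\Psi^+$; if $\Diamond\varphi\in\Phi^-$ then $\Diamond\varphi\in\Psi^-$. A labelled frame is $(W,\preccurlyeq,\ell)$ with $\preccurlyeq$ a partial order and $\ell(w)=(\ell^-(w);\ell^+(w))$ a type for each $w$, such that $w\preccurlyeq v$ implies $\ell(w)\preccurlyeq_T\ell(v)$ and whenever $\varphi\to\psi\in\ell^-(w)$ there is $v\succcurlyeq w$ with $\varphi\in\ell^+(v)$, $\psi\in\ell^-(v)$. A quasimodel is $(W,\preccurlyeq,S,\ell)$ with $(W,\preccurlyeq,\ell)$ a labelled frame and $S\subseteq W\times W$ serial, forward-confluent (if $w\preccurlyeq w'$ and $w\mathrel S v$ there is $v'\succcurlyeq v$ with $w'\mathrel S v'$), sensible ($w\mathrel S x$ implies $\ell(w)\mathrel{S_T}\ell(x)$) and $\omega$-sensible (if $\Diamond\varphi\in\ell^+(w)$ there are $n\ge0$, $v$ with $w\mathrel S^n v$, $\varphi\in\ell^+(v)$). A typed path on $\mathcal Q$ is a sequence $((w_i,\Phi_i))_{i<n}$ with $w_i\mathrel S w_{i+1}$ and $\Phi_i\mathrel{S_T}\Phi_{i+1}$ for $i<n-1$, and $\Phi_i$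 a type with $\Phi_i\sqsubseteq_T\ell(w_i)$ for $i<n$. -}

module Defs where

open import Data.Nat using (ℕ; zero; suc)
open import Data.Fin using (Fin; zero; suc; inject₁)
open import Data.List using (List)
open import Data.List.Membership.Propositional using (_∈_)
open import Data.List.Relation.Binary.Subset.Propositional using (_⊆_)
open import Data.Product using (Σ; ∃; _×_; _,_)
open import Data.Sum using (_⊎_)
open import Data.Empty using (⊥)
open import Relation.Nullary using (¬_)
open import Relation.Binary.PropositionalEquality using (_≡_)
open import Relation.Binary.Structures using (IsPartialOrder)

infixr 6 _∧_
infixr 5 _∨_
infixr 4 _⇒_
data Fm : Set where
  ⊥'  : Fm
  var : ℕ → Fm
  _∧_ : Fm → Fm → Fm
  _∨_ : Fm → Fm → Fm
  _⇒_ : Fm → Fm → Fm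
  ○   : Fm → Fm
  ◇   : Fm → Fm

-- Finite sets of formulas are represented by lists (membership / inclusion
-- are the set-theoretic notions; order and duplicates are irrelevant).
record IsType (neg pos : List Fm) : Set where
  field
    disjoint : ∀ φ → φ ∈ neg → φ ∈ pos → ⊥
    ⊥∉pos    : ¬ (⊥' ∈ pos)
    ∧-pos    : ∀ φ ψ → (φ ∧ ψ) ∈ pos → φ ∈ pos × ψ ∈ pos
    ∧-neg    : ∀ φ ψ → (φ ∧ ψ) ∈ neg → φ ∈ neg ⊎ ψ ∈ neg
    ∨-pos    : ∀ φ ψ → (φ ∨ ψ) ∈ pos → φ ∈ pos ⊎ ψ ∈ pos
    ∨-neg    : ∀ φ ψ → (φ ∨ ψ) ∈ neg → φ ∈ neg × ψ ∈ neg
    ⇒-pos    : ∀ φ ψ → (φ ⇒ ψ) ∈ pos → φ ∈ neg ⊎ ψ ∈ pos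
    ◇-neg    : ∀ φ → ◇ φ ∈ neg → φ ∈ neg

record Type : Set where
  constructor ⟨_︔_⟩by_
  field
    neg    : List Fm
    pos    : List Fm
    isType : IsType neg pos
open Type public

_≼T_ : Type → Type → Set
Φ ≼T Ψ = (neg Ψ ⊆ neg Φ) × (pos Φ ⊆ pos Ψ)

_⊑T_ : Type → Type → Set
Φ ⊑T Ψ = ((neg Φ ⊆ neg Ψ) × (neg Ψ ⊆ neg Φ)) × (pos Φ ⊆ pos Ψ)

_S-T_ : Type → Type → Set
Φ S-T Ψ =
    (∀ φ → ○ φ ∈ pos Φ → φ ∈ pos Ψ)
  × (∀ φ → ○ φ ∈ neg Φ → φ ∈ neg Ψ)
  × (∀ φ → ◇ φ ∈ pos Φ → φ ∈ pos Φ ⊎ ◇ φ ∈ pos Ψ)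
  × (∀ φ → ◇ φ ∈ neg Φ → ◇ φ ∈ neg Ψ)

Iter : {W : Set} → (W → W → Set) → ℕ → W → W → Set
Iter R zero    w v = w ≡ v
Iter R (suc n) w v = ∃ λ u → R w u × Iter R n u v

record Quasimodel : Set₁ where
  field
    W      : Set
    _≼_    : W → W → Set
    ≼-po   : IsPartialOrder _≡_ _≼_
    ℓ      : W → Type
    ℓ-mono : ∀ {w v} → w ≼ v → ℓ w ≼T ℓ v
    ℓ-⇒    : ∀ w φ ψ → (φ ⇒ ψ) ∈ neg (ℓ w) →
               ∃ λ v → w ≼ v × φ ∈ pos (ℓ v) × ψ ∈ neg (ℓ v)
    S          : W → W → Set
    serial     : ∀ w → ∃ λ v → S w v
    fconfluent : ∀ {w w' v} → w ≼ w' → S w v → ∃ λ v' → v ≼ v' × S w' v'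
    sensible   : ∀ {w x} → S w x → ℓ w S-T ℓ x
    ω-sensible : ∀ w φ → ◇ φ ∈ pos (ℓ w) →
                   ∃ λ n → ∃ λ v → Iter S n w v × φ ∈ pos (ℓ v)

-- A typed path ((w_i, Φ_i))_{i < suc m} of length n = suc m ≥ 1
record TypedPath (Q : Quasimodel) (m : ℕ) : Set where
  open Quasimodel Q
  field
    pt    : Fin (suc m) → W
    ty    : Fin (suc m) → Type
    stepS : ∀ (i : Fin m) → S (pt (inject₁ i)) (pt (suc i))
    stepT : ∀ (i : Fin m) → ty (inject₁ i) S-T ty (suc i)
    sub   : ∀ (i : Fin (suc m)) → ty i ⊑T ℓ (pt i)
open TypedPath public

-- The path is lifted in two independent steps.
--   * Worlds: forward confluence says that an S-step out of w can be matched,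
--     up to ≼, by an S-step out of any w' ≽ w.  Iterating this along the path
--     w₀ S w₁ S … S wₘ, starting from the given v₀ ≽ w₀, yields an S-path
--     v₀ S v₁ S … S vₘ with wᵢ ≼ vᵢ for every i (path-lifting, proved for
--     arbitrary relations ≼ and S).
--   * Types: along any S-path of a quasimodel, the labels ℓ(vᵢ) themselves form
--     a typed path (sensibility gives ℓ(vᵢ) S_T ℓ(vᵢ₊₁), and ⊑_T is reflexive).
--     Finally Φᵢ ⊑_T ℓ(wᵢ) ≼_T ℓ(vᵢ) gives Φᵢ ≼_T ℓ(vᵢ).
-- So Ψᵢ := ℓ(vᵢ) is the required lifted typed path.
module Submission where

open import Defs
open import Data.Nat using (ℕ; zero; suc)
open import Data.Fin using (Fin; zero; suc; inject₁)
open import Data.Product using (Σ; _×_; _,_)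
open import Data.List.Relation.Binary.Subset.Propositional.Properties using (⊆-refl; ⊆-trans)
open import Relation.Binary.PropositionalEquality using (_≡_; refl; subst; sym)

IsPath : {W : Set} → (W → W → Set) → (m : ℕ) → (Fin (suc m) → W) → Set
IsPath R m p = ∀ (i : Fin m) → R (p (inject₁ i)) (p (suc i))

module PathLifting {W : Set} (_≼_ S : W → W → Set)
    (fconfluent : ∀ {w w' v} → w ≼ w' → S w v → Σ W λ v' → v ≼ v' × S w' v') where

  Lift : (m : ℕ) → (Fin (suc m) → W) → W → Set
  Lift m p v₀ = Σ (Fin (suc m) → W) λ v →
    (v zero ≡ v₀) × IsPath S m v × (∀ i → p i ≼ v i)

  lift : ∀ m (p : Fin (suc m) → W) → IsPath S m p →
         ∀ v₀ → p zero ≼ v₀ → Lift m p v₀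
  lift zero p _ v₀ p₀≼v₀ = (λ _ → v₀) , refl , (λ ()) , λ { zero → p₀≼v₀ }
  lift (suc m) p path v₀ p₀≼v₀
    with v₁ , p₁≼v₁ , v₀Sv₁ ← fconfluent p₀≼v₀ (path zero)
    with v , v-head , v-path , p≼v ← lift m (λ i → p (suc i)) (λ i → path (suc i)) v₁ p₁≼v₁
    = lifted , refl , lifted-path , p≼lifted
    where
    lifted : Fin (suc (suc m)) → W
    lifted zero    = v₀
    lifted (suc i) = v i

    lifted-path : IsPath S (suc m) lifted
    lifted-path zero    = subst (S v₀) (sym v-head) v₀Sv₁
    lifted-path (suc i) = v-path i

    p≼lifted : ∀ i → p i ≼ lifted i
    p≼lifted zero    = p₀≼v₀
    p≼lifted (suc i) = p≼v i

⊑T-refl : ∀ Φ → Φ ⊑T Φ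
⊑T-refl Φ = (⊆-refl , ⊆-refl) , ⊆-refl

⊑T-≼T-trans : ∀ {Φ Ψ Θ} → Φ ⊑T Ψ → Ψ ≼T Θ → Φ ≼T Θ
⊑T-≼T-trans ((_ , Ψ⁻⊆Φ⁻) , Φ⁺⊆Ψ⁺) (Θ⁻⊆Ψ⁻ , Ψ⁺⊆Θ⁺) =
  ⊆-trans Θ⁻⊆Ψ⁻ Ψ⁻⊆Φ⁻ , ⊆-trans Φ⁺⊆Ψ⁺ Ψ⁺⊆Θ⁺

module _ (Q : Quasimodel) where
  open Quasimodel Q

  labelPath : ∀ m (v : Fin (suc m) → W) → IsPath S m v → TypedPath Q m
  labelPath m v v-path = record
    { pt    = v
    ; ty    = λ i → ℓ (v i)
    ; stepS = v-path
    ; stepT = λ i → sensible (v-path i)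
    ; sub   = λ i → ⊑T-refl (ℓ (v i))
    }

  subtype-≼T-label : ∀ Φ {w v} → Φ ⊑T ℓ w → w ≼ v → Φ ≼T ℓ v
  subtype-≼T-label Φ {w} {v} Φ⊑ℓw w≼v =
    ⊑T-≼T-trans {Φ} {ℓ w} {ℓ v} Φ⊑ℓw (ℓ-mono w≼v)

lemma8p5 : (Q : Quasimodel) (m : ℕ) (P : TypedPath Q m) (v₀ : Quasimodel.W Q) →
    Quasimodel._≼_ Q (pt P zero) v₀ →
    Σ (TypedPath Q m) (λ P' → (pt P' zero ≡ v₀) ×
      (∀ (i : Fin _) → Quasimodel._≼_ Q (pt P i) (pt P' i) × (ty P i ≼T ty P' i)))
lemma8p5 Q m P v₀ w₀≼v₀
  with v , v-head , v-path , w≼v ← PathLifting.lift (Quasimodel._≼_ Q) (Quasimodel.S Q)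
                                      (Quasimodel.fconfluent Q) m (pt P) (stepS P) v₀ w₀≼v₀
  = labelPath Q m v v-path , v-head , λ i →
      w≼v i , subtype-≼T-label Q (ty P i) (sub P i) (w≼v i)
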